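{- Let $P$ be a set of $n$ points on a line $\ell$, let $\mathcal{I}$ be the set of intervals of $\ell$, let $H=H(P,\mathcal{I})$, and let $H'$ be the sub-hypergraph of $H^{\cup}$ (on the same vertex set $P$) consisting of all hyperedges of $H^{\cup}$ of size at least $3$. Then $\chi_{CF}(H')\ge\sqrt{n-1}$.
   Context: $H(P,\mathcal{I})$ is the hypergraph with vertex set $P$ and hyperedges $I\cap P$ for $I\in\mathcal{I}$. For a hypergraph $H=(V,\mathcal{E})$, $H^{\cup}=(V,\{e\cup f: e,f\in\mathcal{E}\})$. A conflict-free colouring of a hypergraph $(V,\mathcal{F})$ is a colouring $\varphi$ of $V$ such that every nonempty $h\in\mathcal{F}$ contains a vertex $x$ with $\varphi(y)\neq\varphi(x)$ for all $y\in h\setminus\{x\}$; $\chi_{CF}$ is the least number of colours of such a colouring. -}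

module Defs where

open import Data.Nat using (ℕ)
open import Data.Fin using (Fin; _≤_)
open import Data.Product using (_×_; ∃-syntax)
open import Data.Sum using (_⊎_)
open import Relation.Nullary using (¬_)
open import Relation.Binary.PropositionalEquality using (_≡_; _≢_)

-- The n points of P on the line ℓ are identified, in their order along ℓ,
-- with Fin n.  The trace I ∩ P of an interval I of ℓ is then a set of
-- consecutive points {x | a ≤ x ≤ b} (or empty).
InInterval : {n : ℕ} → Fin n → Fin n → Fin n → Set
InInterval a b x = a ≤ x × x ≤ b

-- A hyperedge of H^∪ is a union e ∪ f of two hyperedges of H = H(P,𝓘).
-- (Unions involving the empty trace are again traces of intervals, i.e.
-- of the form e ∪ e, so describing edges by two pairs of endpoints covers
-- all hyperedges of H^∪.)
record UnionEdge (n : ℕ) : Set where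
  constructor unionEdge
  field
    a₁ b₁ a₂ b₂ : Fin n

_∈E_ : {n : ℕ} → Fin n → UnionEdge n → Set
x ∈E unionEdge a₁ b₁ a₂ b₂ = InInterval a₁ b₁ x ⊎ InInterval a₂ b₂ x

SizeAtLeast3 : {n : ℕ} → UnionEdge n → Set
SizeAtLeast3 {n} e =
  ∃[ x ] ∃[ y ] ∃[ z ]
    (x ∈E e × y ∈E e × z ∈E e × x ≢ y × x ≢ z × y ≢ z)

IsCFColouringH' : {n k : ℕ} → (Fin n → Fin k) → Set
IsCFColouringH' {n} φ =
  (e : UnionEdge n) → SizeAtLeast3 e →
  ∃[ x ] (x ∈E e × ((y : Fin n) → y ∈E e → y ≢ x → φ y ≢ φ x))

module Submission where

open import Defs
open import Data.Nat using (ℕ; zero; suc; _≤_; _*_; _∸_; z≤n; s≤s)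
import Data.Nat.Properties as ℕ
open import Data.Fin using (Fin; inject₁; combine; _<_) renaming (suc to fsuc; _≤_ to _≤ᶠ_)
open import Data.Fin.Properties
  using (toℕ-injective; toℕ-inject₁; inject₁-injective; ≤̄⇒inject₁<; <⇒≢; <-cmp;
         combine-injective; injective⇒≤)
open import Data.Product using (∃-syntax; _×_; _,_; proj₁; proj₂)
open import Data.Sum using (_⊎_; inj₁; inj₂)
open import Function using (_∘_)
open import Function.Definitions using (Injective)
open import Relation.Nullary using (¬_; contradiction)
open import Relation.Binary.Definitions using (tri<; tri≈; tri>)
open import Relation.Binary.PropositionalEquality using (_≡_; _≢_; refl; sym)

-- For a conflict-free colouring φ of H', the colour pairs (φ p, φ (p+1)) of the
-- n - 1 adjacent pairs of points are pairwise distinct, so n - 1 ≤ k².  Indeed,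
-- if the pairs at p < q had the same colours, then {p, p+1} ∪ {q, q+1} is a
-- hyperedge of H' with at least 3 points in which every point shares its colour
-- with another point (p with q, and p+1 with q+1).

Twinned : {n k : ℕ} → (Fin n → Fin k) → UnionEdge n → Fin n → Set
Twinned φ e x = ∃[ y ] (y ∈E e × y ≢ x × φ y ≡ φ x)

conflictFree⇒¬allTwinned : {n k : ℕ} {φ : Fin n → Fin k} → IsCFColouringH' φ →
  (e : UnionEdge n) → SizeAtLeast3 e → ¬ (∀ x → x ∈E e → Twinned φ e x)
conflictFree⇒¬allTwinned cf e size allTwinned with cf e size
... | x , x∈e , unique with allTwinned x x∈e
...   | y , y∈e , y≢x , φy≡φx = unique y y∈e y≢x φy≡φx

∈-adjacentPair : {m : ℕ} {p : Fin m} {x : Fin (suc m)} →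
  InInterval (inject₁ p) (fsuc p) x → x ≡ inject₁ p ⊎ x ≡ fsuc p
∈-adjacentPair {p = p} {x} (p≤x , x≤p+1) with ℕ.m≤n⇒m<n∨m≡n x≤p+1
... | inj₂ x≡p+1     = inj₂ (toℕ-injective x≡p+1)
... | inj₁ (s≤s x≤p) =
  inj₁ (toℕ-injective (ℕ.≤-antisym (ℕ.≤-trans x≤p (ℕ.≤-reflexive (sym (toℕ-inject₁ p)))) p≤x))

inject₁∈adjacentPair : {m : ℕ} (p : Fin m) → InInterval (inject₁ p) (fsuc p) (inject₁ p)
inject₁∈adjacentPair p = ℕ.≤-refl , ℕ.<⇒≤ (≤̄⇒inject₁< ℕ.≤-refl)

fsuc∈adjacentPair : {m : ℕ} (p : Fin m) → InInterval (inject₁ p) (fsuc p) (fsuc p)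
fsuc∈adjacentPair p = ℕ.<⇒≤ (≤̄⇒inject₁< ℕ.≤-refl) , ℕ.≤-refl

adjacentPairs : {m : ℕ} → Fin m → Fin m → UnionEdge (suc m)
adjacentPairs p q = unionEdge (inject₁ p) (fsuc p) (inject₁ q) (fsuc q)

module AdjacentPairs {m k : ℕ} (φ : Fin (suc m) → Fin k) {p q : Fin m} (p<q : p < q)
  (φp≡φq : φ (inject₁ p) ≡ φ (inject₁ q)) (φp+1≡φq+1 : φ (fsuc p) ≡ φ (fsuc q)) where

  e : UnionEdge (suc m)
  e = adjacentPairs p q

  inject₁p≢fsuc : ∀ {r} → p ≤ᶠ r → inject₁ p ≢ fsuc r
  inject₁p≢fsuc p≤r = <⇒≢ (≤̄⇒inject₁< p≤r)

  inject₁p≢inject₁q : inject₁ p ≢ inject₁ q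
  inject₁p≢inject₁q eq = <⇒≢ p<q (inject₁-injective eq)

  fsucp≢fsucq : fsuc p ≢ fsuc q
  fsucp≢fsucq = <⇒≢ (s≤s p<q)

  size : SizeAtLeast3 e
  size = inject₁ p , fsuc p , fsuc q
       , inj₁ (inject₁∈adjacentPair p) , inj₁ (fsuc∈adjacentPair p) , inj₂ (fsuc∈adjacentPair q)
       , inject₁p≢fsuc ℕ.≤-refl , inject₁p≢fsuc (ℕ.<⇒≤ p<q) , fsucp≢fsucq

  allTwinned : ∀ x → x ∈E e → Twinned φ e x
  allTwinned x (inj₁ x∈[p,p+1]) with ∈-adjacentPair x∈[p,p+1]
  ... | inj₁ refl = inject₁ q , inj₂ (inject₁∈adjacentPair q) , inject₁p≢inject₁q ∘ sym , sym φp≡φq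
  ... | inj₂ refl = fsuc q , inj₂ (fsuc∈adjacentPair q) , fsucp≢fsucq ∘ sym , sym φp+1≡φq+1
  allTwinned x (inj₂ x∈[q,q+1]) with ∈-adjacentPair x∈[q,q+1]
  ... | inj₁ refl = inject₁ p , inj₁ (inject₁∈adjacentPair p) , inject₁p≢inject₁q , φp≡φq
  ... | inj₂ refl = fsuc p , inj₁ (fsuc∈adjacentPair p) , fsucp≢fsucq , φp+1≡φq+1

pairColour : {m k : ℕ} → (Fin (suc m) → Fin k) → Fin m → Fin (k * k)
pairColour φ p = combine (φ (inject₁ p)) (φ (fsuc p))

distinctPairColours : {m k : ℕ} {φ : Fin (suc m) → Fin k} → IsCFColouringH' φ →
  {p q : Fin m} → p < q → pairColour φ p ≢ pairColour φ q
distinctPairColours {φ = φ} cf {p} {q} p<q eq =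
  conflictFree⇒¬allTwinned cf AP.e AP.size AP.allTwinned
  where
  colours : φ (inject₁ p) ≡ φ (inject₁ q) × φ (fsuc p) ≡ φ (fsuc q)
  colours = combine-injective (φ (inject₁ p)) (φ (fsuc p)) (φ (inject₁ q)) (φ (fsuc q)) eq
  module AP = AdjacentPairs φ p<q (proj₁ colours) (proj₂ colours)

pairColour-injective : {m k : ℕ} {φ : Fin (suc m) → Fin k} →
  IsCFColouringH' φ → Injective _≡_ _≡_ (pairColour φ)
pairColour-injective cf {p} {q} eq with <-cmp p q
... | tri< p<q _ _ = contradiction eq (distinctPairColours cf p<q)
... | tri≈ _ p≡q _ = p≡q
... | tri> _ _ q<p = contradiction (sym eq) (distinctPairColours cf q<p)

theorem5p3 : (n k : ℕ) (φ : Fin n → Fin k) → IsCFColouringH' φ → n ∸ 1 ≤ k * k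
theorem5p3 zero    k φ cf = z≤n
theorem5p3 (suc m) k φ cf = injective⇒≤ (pairColour-injective cf)
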